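{- Let $S_1,\ldots,S_r\in\mathcal{S}$ and $\epsilon\ge 0$ be such that $x:=\frac{1}{r}\sum_{j'=1}^r\chi^{S_{j'}}$ satisfies $x(\delta(s))=x(\delta(t))=1$ and $x^*(F)-\epsilon\le x(F)\le x^*(F)+\epsilon$ for all $F\subseteq E$. Let $0\le h<i\le\ell$ and $1\le j\le r$ with $j\le\theta_h$ and $j\le\theta_i$, where $\theta_m:=\lceil r(2-x^*(C_m)-\epsilon)\rceil$. Then there exists an index $k\ge j$ such that $S_k\cap C_h\cap C_i=\emptyset$.
   Context: $V$ is a finite set, $s,t\in V$ with $s\neq t$, and $E$ is the edge set of the complete graph on $V$. For $U\subseteq V$, $\delta(U)$ is the set of edges with exactly one endpoint in $U$ and $\delta(v):=\delta(\{v\})$. For $x\in\mathbb{R}^E$ and $F\subseteq E$, $x(F):=\sum_{e\in F}x_e$; $\chi^F$ is the characteristic vector of $F$. $x^*$ is a fixed optimal solution of the LP: minimize $\sum_e c_ex_e$ (for a given metric $c$ on $V$) subject to $x(\delta(U))\ge 2$ for all $\emptyset\ne U\subsetneq V$ with $|U\cap\{s,t\}|$ even, $x(\delta(U))\ge 1$ for all $\emptyset\ne U\subsetneq V$ with $|U\cap\{s,t\}|$ odd, $x(\delta(v))=2$ for $v\in V\setminus\{s,t\}$, $x(\delta(v))=1$ for $v\in\{s,t\}$, $x\ge 0$. $\mathcal{S}$ is the set of edge sets of spanning trees of $(V,E)$. A narrow cut is a cut $C=\delta(U)$ with $x^*(C)<2$. It is known that the narrow cuts form a chain: there are sets $\{s\}=U_0\subset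 U_1\subset\cdots\subset U_\ell=V\setminus\{t\}$ such that the narrow cuts are exactly $C_i:=\delta(U_i)$, $i=0,\ldots,\ell$. -}

module Defs where

open import Level using (0ℓ)
open import Algebra.Bundles using (CommutativeRing)
open import Relation.Binary.Structures using (IsTotalOrder)
open import Relation.Nullary using (¬_; Dec; yes; no)
open import Relation.Nullary.Decidable using (⌊_⌋)
open import Relation.Binary.PropositionalEquality using (_≡_; _≢_)
open import Data.Bool using (Bool; true; false; _∧_; _xor_; not; if_then_else_)
open import Data.Nat as ℕ using (ℕ; zero; suc)
open import Data.Integer as ℤ using (ℤ; +_; -[1+_])
open import Data.Fin as Fin using (Fin)
open import Data.Fin.Properties using (_≟_; _<?_)
open import Data.List using (List; []; _∷_; length)
open import Data.List.Relation.Unary.Unique.Propositional using (Unique)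
open import Data.Product using (Σ; _×_; _,_; ∃; ∃-syntax)
open import Data.Sum using (_⊎_)
open import Data.Unit using (⊤)

-- A commutative ring with a total
-- order compatible with + and *, 0 ≠ 1, and multiplicative inverses of
-- nonzero elements (_⁻¹ is total; its value at 0 is irrelevant).

record OrderedField : Set₁ where
  field
    commRing : CommutativeRing 0ℓ 0ℓ
  open CommutativeRing commRing public
  infix 4 _≤_
  infix 8 _⁻¹
  field
    _≤_          : Carrier → Carrier → Set
    isTotalOrder : IsTotalOrder _≈_ _≤_
    +-mono-≤     : ∀ {a b} c → a ≤ b → (a + c) ≤ (b + c)
    *-nonneg     : ∀ {a b} → 0# ≤ a → 0# ≤ b → 0# ≤ (a * b)
    0≉1          : ¬ (0# ≈ 1#)
    _⁻¹          : Carrier → Carrier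
    ⁻¹-inverse   : ∀ a → ¬ (a ≈ 0#) → (a * a ⁻¹) ≈ 1#

  infix 4 _<_
  _<_ : Carrier → Carrier → Set
  a < b = (a ≤ b) × ¬ (a ≈ b)

  fromℕ : ℕ → Carrier
  fromℕ zero    = 0#
  fromℕ (suc m) = 1# + fromℕ m

  fromℤ : ℤ → Carrier
  fromℤ (+ m)      = fromℕ m
  fromℤ -[1+ m ]   = - fromℕ (suc m)

  2# : Carrier
  2# = fromℕ 2

  IsCeiling : Carrier → ℤ → Set
  IsCeiling a z = ((fromℤ z - 1#) < a) × (a ≤ fromℤ z)

  sumℕ : ℕ → (ℕ → Carrier) → Carrier
  sumℕ zero    f = 0#
  sumℕ (suc m) f = f m + sumℕ m f

  sumFin : ∀ {m} → (Fin m → Carrier) → Carrier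
  sumFin {zero}  f = 0#
  sumFin {suc m} f = f Fin.zero + sumFin (λ i → f (Fin.suc i))

-- The complete graph on V = Fin n.  An edge {u,v} is represented by the
-- ordered pair (u , v) with u < v; the entries of edge-indexed objects at
-- pairs with ¬ (u < v) are ignored.

module Graph (K : OrderedField) (n : ℕ) where
  open OrderedField K

  Vertex : Set
  Vertex = Fin n

  VSet : Set
  VSet = Vertex → Bool

  EdgeSet : Set
  EdgeSet = Vertex → Vertex → Bool

  EdgeVec : Set
  EdgeVec = Vertex → Vertex → Carrier

  isEdge : Vertex → Vertex → Bool
  isEdge u v = ⌊ u <? v ⌋

  _⟨_⟩ : EdgeVec → EdgeSet → Carrier
  x ⟨ F ⟩ = sumFin (λ u → sumFin (λ v →
              if isEdge u v ∧ F u v then x u v else 0#))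

  allE : EdgeSet
  allE u v = true

  _∩_ : EdgeSet → EdgeSet → EdgeSet
  (F ∩ G) u v = F u v ∧ G u v

  χ : EdgeSet → EdgeVec
  χ F u v = if F u v then 1# else 0#

  δ : VSet → EdgeSet
  δ U u v = U u xor U v

  singleton : Vertex → VSet
  singleton w u = ⌊ u ≟ w ⌋

  δv : Vertex → EdgeSet
  δv w = δ (singleton w)

  NonemptyProper : VSet → Set
  NonemptyProper U = (∃[ u ] U u ≡ true) × (∃[ u ] U u ≡ false)

  IsMetric : (Vertex → Vertex → Carrier) → Set
  IsMetric c = (∀ u → c u u ≈ 0#)
             × (∀ u v → c u v ≈ c v u)
             × (∀ u v → 0# ≤ c u v)
             × (∀ u v w → c u w ≤ (c u v + c v w))

  cost : (Vertex → Vertex → Carrier) → EdgeVec → Carrier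
  cost c x = (λ u v → c u v * x u v) ⟨ allE ⟩

  -- feasibility for the s-t path TSP LP relaxation
  -- (|U ∩ {s,t}| is odd iff U s xor U t ≡ true)
  LPFeasible : Vertex → Vertex → EdgeVec → Set
  LPFeasible s t y =
      (∀ U → NonemptyProper U → (U s xor U t) ≡ false → 2# ≤ y ⟨ δ U ⟩)
    × (∀ U → NonemptyProper U → (U s xor U t) ≡ true  → 1# ≤ y ⟨ δ U ⟩)
    × (∀ v → v ≢ s → v ≢ t → y ⟨ δv v ⟩ ≈ 2#)
    × (y ⟨ δv s ⟩ ≈ 1#)
    × (y ⟨ δv t ⟩ ≈ 1#)
    × (∀ u v → isEdge u v ≡ true → 0# ≤ y u v)

  LPOptimal : (Vertex → Vertex → Carrier) → Vertex → Vertex → EdgeVec → Set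
  LPOptimal c s t x* =
    LPFeasible s t x* × (∀ y → LPFeasible s t y → cost c x* ≤ cost c y)

  adj : EdgeSet → Vertex → Vertex → Bool
  adj T u v = (isEdge u v ∧ T u v) Data.Bool.∨ (isEdge v u ∧ T v u)

  data Walk (T : EdgeSet) : Vertex → Vertex → Set where
    here : ∀ {u} → Walk T u u
    step : ∀ {u w v} → adj T u w ≡ true → Walk T w v → Walk T u v

  Connected : EdgeSet → Set
  Connected T = ∀ u v → Walk T u v

  ChainAdj : EdgeSet → Vertex → List Vertex → Set
  ChainAdj T first []           = ⊤
  ChainAdj T first (v ∷ [])     = adj T v first ≡ true
  ChainAdj T first (v ∷ w ∷ vs) = (adj T v w ≡ true) × ChainAdj T first (w ∷ vs)

  Cycle : EdgeSet → Set
  Cycle T = Σ (List Vertex) λ vs →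
              (3 ℕ.≤ length vs) × Unique vs × CycleAdj vs
    where
      CycleAdj : List Vertex → Set
      CycleAdj []       = ⊤
      CycleAdj (v ∷ vs) = ChainAdj T v (v ∷ vs)

  Acyclic : EdgeSet → Set
  Acyclic T = ¬ Cycle T

  IsSpanningTree : EdgeSet → Set
  IsSpanningTree T = Connected T × Acyclic T

  -- the narrow cuts of x* are exactly C_m = δ(U_m), m = 0..ℓ, where
  -- {s} = U₀ ⊂ U₁ ⊂ ⋯ ⊂ U_ℓ = V ∖ {t}
  NarrowChain : Vertex → Vertex → EdgeVec → ℕ → (ℕ → VSet) → Set
  NarrowChain s t x* ℓ U =
      (∀ w → U 0 w ≡ singleton s w)
    × (∀ w → U ℓ w ≡ not (singleton t w))
    × (∀ m → m ℕ.< ℓ → (∀ w → U m w ≡ true → U (suc m) w ≡ true)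
                      × (∃[ w ] (U m w ≡ false × U (suc m) w ≡ true)))
    × (∀ m → m ℕ.≤ ℓ → x* ⟨ δ (U m) ⟩ < 2#)
    × (∀ W → NonemptyProper W → x* ⟨ δ W ⟩ < 2# →
         ∃[ m ] (m ℕ.≤ ℓ × (∀ u v → δ W u v ≡ δ (U m) u v)))

-- Suppose every S_k with k ≥ j meets C_h ∩ C_i.  Then r · x(C_h ∩ C_i) ≥ r - j + 1.
-- The set W = U_i ∖ U_h contains neither s nor t, so x*(δ(W)) ≥ 2; as δ(W) = C_h △ C_i,
-- x*(C_h) + x*(C_i) = x*(δ(W)) + 2 x*(C_h ∩ C_i) ≥ 2 + 2 x*(C_h ∩ C_i).  Adding the two
-- ceiling bounds j - 1 < r (2 - x*(C_m) - ε), m = h, i, and using x ≤ x* + ε then gives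
-- r · x(C_h ∩ C_i) < r - j + 1.
module Submission where

open import Defs
open import Data.Bool as Bool using (true; false; _∧_; _xor_; not; if_then_else_)
open import Data.Bool.Properties using (xor-assoc; xor-comm; ∧-assoc)
open import Data.Empty using (⊥; ⊥-elim)
open import Data.Fin as Fin using (Fin)
open import Data.Fin.Properties using (any?; _≟_)
open import Data.Integer as ℤ using (ℤ; +_; +≤+)
open import Data.Nat as ℕ using (ℕ; zero; suc; z≤n; s≤s; s≤s⁻¹)
import Data.Nat.Properties as ℕ
open import Data.Product using (_×_; _,_; proj₁; proj₂; ∃-syntax)
open import Data.Sum as Sum using (_⊎_; inj₁; inj₂)
open import Function using (_∘_; id)
open import Level using (0ℓ)
open import Relation.Binary.Bundles using (Poset)
import Relation.Binary.Reasoning.PartialOrder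
open import Relation.Binary.Structures using (IsTotalOrder)
open import Relation.Binary.PropositionalEquality as ≡ using (_≡_; _≢_)
open import Relation.Nullary using (¬_; yes; no)
open import Relation.Nullary.Decidable using (isYes≗does; dec-true)
open import Relation.Nullary.Negation using (contradiction)

xor-interchange : ∀ a b c d → (a xor b) xor (c xor d) ≡ (a xor c) xor (b xor d)
xor-interchange a b c d = begin
  (a xor b) xor (c xor d)   ≡⟨ xor-assoc a b (c xor d) ⟩
  a xor (b xor (c xor d))   ≡⟨ ≡.cong (a xor_) (xor-assoc b c d) ⟨
  a xor ((b xor c) xor d)   ≡⟨ ≡.cong (λ z → a xor (z xor d)) (xor-comm b c) ⟩
  a xor ((c xor b) xor d)   ≡⟨ ≡.cong (a xor_) (xor-assoc c b d) ⟩
  a xor (c xor (b xor d))   ≡⟨ xor-assoc a c (b xor d) ⟨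
  (a xor c) xor (b xor d)   ∎
  where open ≡.≡-Reasoning

module _ {p q} {P : ℕ → Set p} {Q : ℕ → Set q} (P⊎Q : ∀ k → P k ⊎ Q k) where

  private
    extend : ∀ {j m} → (∀ k → j ℕ.≤ k → k ℕ.< m → Q k) → (j ℕ.≤ m → Q m) →
             ∀ k → j ℕ.≤ k → k ℕ.< suc m → Q k
    extend below qm k j≤k k<1+m with ℕ.m<1+n⇒m<n∨m≡n k<1+m
    ... | inj₁ k<m    = below k j≤k k<m
    ... | inj₂ ≡.refl = qm j≤k

  bounded-search : ∀ j m → (∃[ k ] (j ℕ.≤ k × k ℕ.< m × P k)) ⊎ (∀ k → j ℕ.≤ k → k ℕ.< m → Q k)
  bounded-search j zero = inj₂ (λ _ _ ())
  bounded-search j (suc m) with bounded-search j m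
  ... | inj₁ (k , j≤k , k<m , pk) = inj₁ (k , j≤k , ℕ.m<n⇒m<1+n k<m , pk)
  ... | inj₂ below with j ℕ.≤? m
  ...   | no j≰m  = inj₂ (extend below (λ j≤m → contradiction j≤m j≰m))
  ...   | yes j≤m with P⊎Q m
  ...     | inj₁ pm = inj₁ (m , j≤m , ℕ.n<1+n m , pm)
  ...     | inj₂ qm = inj₂ (extend below (λ _ → qm))

module OrderedFieldProperties (K : OrderedField) where
  open OrderedField K hiding (+-mono-≤)
  open IsTotalOrder isTotalOrder using (isPartialOrder; total; antisym)
    renaming (refl to ≤-refl; trans to ≤-trans)
  open import Algebra.Properties.Ring ring using (+-cancelʳ; -‿involutive; -1*x≈-x)
  open import Algebra.Properties.Semiring.Sum semiring
    using (sum; sum-cong-≋; ∑-distrib-+; *-distribˡ-sum; sum-replicate-zero)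
  open import Algebra.Solver.Ring.NaturalCoefficients.Default commutativeSemiring
    using (solve; _:+_; _:*_; _:=_; con)

  poset : Poset 0ℓ 0ℓ 0ℓ
  poset = record { isPartialOrder = isPartialOrder }

  module ≤-Reasoning = Relation.Binary.Reasoning.PartialOrder poset
  open ≤-Reasoning

  +-monoˡ-≤ : ∀ {a b} c → a ≤ b → a + c ≤ b + c
  +-monoˡ-≤ = OrderedField.+-mono-≤ K

  +-monoʳ-≤ : ∀ {a b} c → a ≤ b → c + a ≤ c + b
  +-monoʳ-≤ {a} {b} c a≤b = begin
    c + a ≈⟨ +-comm c a ⟩
    a + c ≤⟨ +-monoˡ-≤ c a≤b ⟩
    b + c ≈⟨ +-comm b c ⟩
    c + b ∎

  +-mono-≤ : ∀ {a b c d} → a ≤ b → c ≤ d → a + c ≤ b + d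
  +-mono-≤ {b = b} {c} a≤b c≤d = ≤-trans (+-monoˡ-≤ c a≤b) (+-monoʳ-≤ b c≤d)

  +-mono-<-≤ : ∀ {a b c d} → a < b → c ≤ d → a + c < b + d
  +-mono-<-≤ {a} {b} {c} {d} (a≤b , a≉b) c≤d =
    +-mono-≤ a≤b c≤d , λ eq → a≉b (+-cancelʳ c a b (antisym (+-monoˡ-≤ c a≤b) (begin
      b + c ≤⟨ +-monoʳ-≤ b c≤d ⟩
      b + d ≈⟨ sym eq ⟩
      a + c ∎)))

  +-mono-< : ∀ {a b c d} → a < b → c < d → a + c < b + d
  +-mono-< a<b (c≤d , _) = +-mono-<-≤ a<b c≤d

  -- if 1 ≤ 0 then 0 ≤ -1, so 0 ≤ (-1)(-1) = 1
  0≤1 : 0# ≤ 1#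
  0≤1 with total 0# 1#
  ... | inj₁ 0≤1 = 0≤1
  ... | inj₂ 1≤0 = begin
    0#            ≤⟨ *-nonneg 0≤-1 0≤-1 ⟩
    - 1# * - 1#   ≈⟨ -1*x≈-x (- 1#) ⟩
    - (- 1#)      ≈⟨ -‿involutive 1# ⟩
    1# ∎
    where
    0≤-1 : 0# ≤ - 1#
    0≤-1 = begin
      0#          ≈⟨ -‿inverseʳ 1# ⟨
      1# + - 1#   ≤⟨ +-monoˡ-≤ (- 1#) 1≤0 ⟩
      0# + - 1#   ≈⟨ +-identityˡ (- 1#) ⟩
      - 1# ∎

  *-monoˡ-≤-nonNeg : ∀ {a b} c → 0# ≤ c → a ≤ b → c * a ≤ c * b
  *-monoˡ-≤-nonNeg {a} {b} c 0≤c a≤b = begin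
    c * a                  ≈⟨ +-identityˡ (c * a) ⟨
    0# + c * a             ≤⟨ +-monoˡ-≤ (c * a) (*-nonneg 0≤c 0≤b-a) ⟩
    c * (b - a) + c * a    ≈⟨ distribˡ c (b - a) a ⟨
    c * ((b - a) + a)      ≈⟨ *-congˡ (b-a+a≈b) ⟩
    c * b ∎
    where
    0≤b-a : 0# ≤ b - a
    0≤b-a = begin
      0#      ≈⟨ -‿inverseʳ a ⟨
      a - a   ≤⟨ +-monoˡ-≤ (- a) a≤b ⟩
      b - a ∎
    b-a+a≈b : (b - a) + a ≈ b
    b-a+a≈b = trans (+-assoc b (- a) a) (trans (+-congˡ (-‿inverseˡ a)) (+-identityʳ b))

  fromℕ-nonNeg : ∀ m → 0# ≤ fromℕ m
  fromℕ-nonNeg zero    = ≤-refl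
  fromℕ-nonNeg (suc m) = begin
    0#             ≈⟨ +-identityˡ 0# ⟨
    0# + 0#        ≤⟨ +-mono-≤ 0≤1 (fromℕ-nonNeg m) ⟩
    1# + fromℕ m ∎

  fromℕ-+ : ∀ m k → fromℕ (m ℕ.+ k) ≈ fromℕ m + fromℕ k
  fromℕ-+ zero    k = sym (+-identityˡ (fromℕ k))
  fromℕ-+ (suc m) k = trans (+-congˡ (fromℕ-+ m k)) (sym (+-assoc 1# (fromℕ m) (fromℕ k)))

  fromℕ-mono-≤ : ∀ {m k} → m ℕ.≤ k → fromℕ m ≤ fromℕ k
  fromℕ-mono-≤ {m} {k} m≤k = begin
    fromℕ m                       ≈⟨ +-identityʳ (fromℕ m) ⟨
    fromℕ m + 0#                  ≤⟨ +-monoʳ-≤ (fromℕ m) (fromℕ-nonNeg (k ℕ.∸ m)) ⟩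
    fromℕ m + fromℕ (k ℕ.∸ m)     ≈⟨ fromℕ-+ m (k ℕ.∸ m) ⟨
    fromℕ (m ℕ.+ (k ℕ.∸ m))       ≡⟨ ≡.cong fromℕ (ℕ.m+[n∸m]≡n m≤k) ⟩
    fromℕ k ∎

  fromℕ-suc≉0 : ∀ m → ¬ (fromℕ (suc m) ≈ 0#)
  fromℕ-suc≉0 m 1+m≈0 = 0≉1 (antisym 0≤1 (begin
    1#             ≈⟨ +-identityʳ 1# ⟨
    1# + 0#        ≤⟨ +-monoʳ-≤ 1# (fromℕ-nonNeg m) ⟩
    1# + fromℕ m   ≈⟨ 1+m≈0 ⟩
    0# ∎))

  IsCeiling-suc≤⇒< : ∀ {a z} j → IsCeiling a z → + suc j ℤ.≤ z → fromℕ j < a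
  IsCeiling-suc≤⇒< {a} {+ m} j (z-1<a , _) (+≤+ 1+j≤m) = begin-strict
    fromℕ j                  ≈⟨ 1+j-1≈j ⟨
    fromℕ (suc j) - 1#       ≤⟨ +-monoˡ-≤ (- 1#) (fromℕ-mono-≤ 1+j≤m) ⟩
    fromℕ m - 1#             <⟨ z-1<a ⟩
    a ∎
    where
    1+j-1≈j : fromℕ (suc j) - 1# ≈ fromℕ j
    1+j-1≈j = trans (solve 2 (λ x y → (con 1 :+ x) :+ y := x :+ (con 1 :+ y)) refl (fromℕ j) (- 1#))
                    (trans (+-congˡ (-‿inverseʳ 1#)) (+-identityʳ (fromℕ j)))

  sumFin≡sum : ∀ {m} (f : Fin m → Carrier) → sumFin f ≡ sum f
  sumFin≡sum {zero}  f = ≡.refl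
  sumFin≡sum {suc m} f = ≡.cong (λ x → f Fin.zero + x) (sumFin≡sum (λ i → f (Fin.suc i)))

  sumFin-cong : ∀ {m} {f g : Fin m → Carrier} → (∀ i → f i ≈ g i) → sumFin f ≈ sumFin g
  sumFin-cong {f = f} {g} f≈g rewrite sumFin≡sum f | sumFin≡sum g = sum-cong-≋ f≈g

  sumFin-+ : ∀ {m} (f g : Fin m → Carrier) → sumFin (λ i → f i + g i) ≈ sumFin f + sumFin g
  sumFin-+ f g rewrite sumFin≡sum (λ i → f i + g i) | sumFin≡sum f | sumFin≡sum g = ∑-distrib-+ f g

  sumFin-* : ∀ {m} c (f : Fin m → Carrier) → sumFin (λ i → c * f i) ≈ c * sumFin f
  sumFin-* c f rewrite sumFin≡sum (λ i → c * f i) | sumFin≡sum f = sym (*-distribˡ-sum c f)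

  sumFin-zero : ∀ m → sumFin {m} (λ _ → 0#) ≈ 0#
  sumFin-zero m rewrite sumFin≡sum {m} (λ _ → 0#) = sum-replicate-zero m

  sumFin-nonNeg : ∀ {m} (f : Fin m → Carrier) → (∀ i → 0# ≤ f i) → 0# ≤ sumFin f
  sumFin-nonNeg {zero}  f 0≤f = ≤-refl
  sumFin-nonNeg {suc m} f 0≤f = begin
    0#       ≈⟨ +-identityˡ 0# ⟨
    0# + 0#  ≤⟨ +-mono-≤ (0≤f Fin.zero) (sumFin-nonNeg _ (λ i → 0≤f (Fin.suc i))) ⟩
    sumFin f ∎

  sumFin-≥-term : ∀ {m} (f : Fin m → Carrier) → (∀ i → 0# ≤ f i) → ∀ i → f i ≤ sumFin f
  sumFin-≥-term f 0≤f Fin.zero = begin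
    f Fin.zero       ≈⟨ +-identityʳ _ ⟨
    f Fin.zero + 0#  ≤⟨ +-monoʳ-≤ _ (sumFin-nonNeg _ (λ i → 0≤f (Fin.suc i))) ⟩
    sumFin f ∎
  sumFin-≥-term f 0≤f (Fin.suc i) = begin
    f (Fin.suc i)       ≈⟨ +-identityˡ _ ⟨
    0# + f (Fin.suc i)  ≤⟨ +-mono-≤ (0≤f Fin.zero) (sumFin-≥-term _ (λ i → 0≤f (Fin.suc i)) i) ⟩
    sumFin f ∎

  sumℕ-nonNeg : ∀ m (g : ℕ → Carrier) → (∀ k → 0# ≤ g k) → 0# ≤ sumℕ m g
  sumℕ-nonNeg zero    g 0≤g = ≤-refl
  sumℕ-nonNeg (suc m) g 0≤g = begin
    0#       ≈⟨ +-identityˡ 0# ⟨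
    0# + 0#  ≤⟨ +-mono-≤ (0≤g m) (sumℕ-nonNeg m g 0≤g) ⟩
    sumℕ (suc m) g ∎

  -- m ∸ j ≤ Σ_{k<m} g k, stated without truncated subtraction
  sumℕ-≥-count : ∀ j m (g : ℕ → Carrier) → (∀ k → 0# ≤ g k) →
                 (∀ k → j ℕ.≤ k → k ℕ.< m → 1# ≤ g k) → fromℕ m ≤ fromℕ j + sumℕ m g
  sumℕ-≥-count j zero    g 0≤g 1≤g = begin
    0#                 ≈⟨ +-identityʳ 0# ⟨
    0# + 0#            ≤⟨ +-mono-≤ (fromℕ-nonNeg j) ≤-refl ⟩
    fromℕ j + 0# ∎
  sumℕ-≥-count j (suc m) g 0≤g 1≤g with j ℕ.≤? m
  ... | yes j≤m = begin
    1# + fromℕ m                  ≤⟨ +-mono-≤ (1≤g m j≤m ℕ.≤-refl)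
                                      (sumℕ-≥-count j m g 0≤g (λ k j≤k k<m → 1≤g k j≤k (ℕ.m<n⇒m<1+n k<m))) ⟩
    g m + (fromℕ j + sumℕ m g)    ≈⟨ solve 3 (λ x y z → x :+ (y :+ z) := y :+ (x :+ z)) refl (g m) (fromℕ j) (sumℕ m g) ⟩
    fromℕ j + sumℕ (suc m) g ∎
  ... | no j≰m = begin
    fromℕ (suc m)             ≤⟨ fromℕ-mono-≤ (ℕ.≰⇒> j≰m) ⟩
    fromℕ j                   ≈⟨ +-identityʳ (fromℕ j) ⟨
    fromℕ j + 0#              ≤⟨ +-monoʳ-≤ (fromℕ j) (sumℕ-nonNeg (suc m) g 0≤g) ⟩
    fromℕ j + sumℕ (suc m) g ∎

  x*2≈x+x : ∀ x → x * 2# ≈ x + x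
  x*2≈x+x = solve 1 (λ x → x :* (con 1 :+ (con 1 :+ con 0)) := x :+ x) refl

  x<r[c-a-e]⇒x+r[a+e]<rc : ∀ {J} R c a ε → J < R * ((c - a) - ε) → J + R * (a + ε) < R * c
  x<r[c-a-e]⇒x+r[a+e]<rc {J} R c a ε J< = begin-strict
    J + R * (a + ε)                     <⟨ +-mono-<-≤ J< ≤-refl ⟩
    R * ((c - a) - ε) + R * (a + ε)     ≈⟨ distribˡ R ((c - a) - ε) (a + ε) ⟨
    R * (((c - a) - ε) + (a + ε))       ≈⟨ *-congˡ cancel ⟩
    R * c ∎
    where
    cancel : ((c - a) - ε) + (a + ε) ≈ c
    cancel = trans (solve 5 (λ c a ε -a -ε → ((c :+ -a) :+ -ε) :+ (a :+ ε) := c :+ ((a :+ -a) :+ (ε :+ -ε)))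
                            refl c a ε (- a) (- ε))
             (trans (+-congˡ (+-cong (-‿inverseʳ a) (-‿inverseʳ ε)))
             (trans (+-congˡ (+-identityʳ 0#)) (+-identityʳ c)))

  two-ceilings-absurd : ∀ {R J a b d f y ε} → 0# ≤ R →
    J < R * ((2# - a) - ε) → J < R * ((2# - b) - ε) →
    2# ≤ d → a + b ≈ d + (f + f) → y ≤ f + ε → R ≤ J + R * y → ⊥
  two-ceilings-absurd {R} {J} {a} {b} {d} {f} {y} {ε} 0≤R J<ₐ J<ᵦ 2≤d a+b≈ y≤ R≤ = begin-contradiction
    R * 2# + R * 2#                                   ≈⟨ +-congʳ (x*2≈x+x R) ⟩
    (R + R) + R * 2#                                  ≤⟨ +-monoˡ-≤ (R * 2#) (+-mono-≤ R≤ R≤) ⟩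
    ((J + R * y) + (J + R * y)) + R * 2#              ≤⟨ +-monoˡ-≤ (R * 2#) (+-mono-≤ Ry≤ Ry≤) ⟩
    ((J + R * (f + ε)) + (J + R * (f + ε))) + R * 2#  ≈⟨ solve 5 (λ R J f ε t →
      ((J :+ R :* (f :+ ε)) :+ (J :+ R :* (f :+ ε))) :+ R :* t := ((J :+ J) :+ (R :* ε :+ R :* ε)) :+ R :* (t :+ (f :+ f)))
      refl R J f ε 2# ⟩
    ((J + J) + (R * ε + R * ε)) + R * (2# + (f + f))  ≤⟨ +-monoʳ-≤ _ (*-monoˡ-≤-nonNeg R 0≤R 2+2f≤a+b) ⟩
    ((J + J) + (R * ε + R * ε)) + R * (a + b)         ≈⟨ solve 5 (λ R J a b ε →
      ((J :+ J) :+ (R :* ε :+ R :* ε)) :+ R :* (a :+ b) := (J :+ R :* (a :+ ε)) :+ (J :+ R :* (b :+ ε)))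
      refl R J a b ε ⟩
    (J + R * (a + ε)) + (J + R * (b + ε))             <⟨ +-mono-< (x<r[c-a-e]⇒x+r[a+e]<rc R 2# a ε J<ₐ) (x<r[c-a-e]⇒x+r[a+e]<rc R 2# b ε J<ᵦ) ⟩
    R * 2# + R * 2# ∎
    where
    Ry≤ : J + R * y ≤ J + R * (f + ε)
    Ry≤ = +-monoʳ-≤ J (*-monoˡ-≤-nonNeg R 0≤R y≤)
    2+2f≤a+b : 2# + (f + f) ≤ a + b
    2+2f≤a+b = begin
      2# + (f + f)  ≤⟨ +-monoˡ-≤ (f + f) 2≤d ⟩
      d + (f + f)   ≈⟨ a+b≈ ⟨
      a + b ∎

module GraphProperties (K : OrderedField) (n : ℕ) where
  open OrderedField K hiding (+-mono-≤)
  open OrderedFieldProperties K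
  open Graph K n
  open IsTotalOrder isTotalOrder using () renaming (refl to ≤-refl)
  open ≤-Reasoning

  restrict : EdgeVec → EdgeSet → EdgeVec
  restrict x F u v = if isEdge u v ∧ F u v then x u v else 0#

  sumE : EdgeVec → Carrier
  sumE x = sumFin (λ u → sumFin (λ v → x u v))

  sumE-cong : ∀ {x y} → (∀ u v → x u v ≈ y u v) → sumE x ≈ sumE y
  sumE-cong x≈y = sumFin-cong {n} (λ u → sumFin-cong {n} (x≈y u))

  sumE-+ : ∀ x y → sumE (λ u v → x u v + y u v) ≈ sumE x + sumE y
  sumE-+ x y = trans (sumFin-cong {n} (λ u → sumFin-+ {n} (x u) (y u))) (sumFin-+ {n} _ _)

  if-+ : ∀ b (p q : Carrier) → (if b then p + q else 0#) ≈ (if b then p else 0#) + (if b then q else 0#)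
  if-+ true  p q = refl
  if-+ false p q = sym (+-identityʳ 0#)

  if-* : ∀ b (c p : Carrier) → (if b then c * p else 0#) ≈ c * (if b then p else 0#)
  if-* true  c p = refl
  if-* false c p = sym (zeroʳ c)

  ⟨⟩-zero : ∀ F → (λ _ _ → 0#) ⟨ F ⟩ ≈ 0#
  ⟨⟩-zero F = begin-equality
    (λ _ _ → 0#) ⟨ F ⟩   ≈⟨ sumE-cong (λ u v → if-0 (isEdge u v ∧ F u v)) ⟩
    sumE (λ _ _ → 0#)    ≈⟨ trans (sumFin-cong {n} (λ _ → sumFin-zero n)) (sumFin-zero n) ⟩
    0# ∎
    where
    if-0 : ∀ b → (if b then 0# else 0#) ≈ 0#
    if-0 true  = refl
    if-0 false = refl

  ⟨⟩-+ : ∀ x y F → (λ u v → x u v + y u v) ⟨ F ⟩ ≈ x ⟨ F ⟩ + y ⟨ F ⟩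
  ⟨⟩-+ x y F = trans (sumE-cong (λ u v → if-+ (isEdge u v ∧ F u v) (x u v) (y u v))) (sumE-+ _ _)

  ⟨⟩-* : ∀ c x F → (λ u v → c * x u v) ⟨ F ⟩ ≈ c * x ⟨ F ⟩
  ⟨⟩-* c x F = trans (sumE-cong (λ u v → if-* (isEdge u v ∧ F u v) c (x u v)))
                     (trans (sumFin-cong {n} (λ u → sumFin-* {n} c _)) (sumFin-* {n} c _))

  ⟨⟩-sumℕ : ∀ m (x : ℕ → EdgeVec) F → (λ u v → sumℕ m (λ k → x k u v)) ⟨ F ⟩ ≈ sumℕ m (λ k → x k ⟨ F ⟩)
  ⟨⟩-sumℕ zero    x F = ⟨⟩-zero F
  ⟨⟩-sumℕ (suc m) x F = trans (⟨⟩-+ (x m) _ F) (+-congˡ (⟨⟩-sumℕ m x F))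

  infixl 6 _△_ _△ᵥ_

  _△_ : EdgeSet → EdgeSet → EdgeSet
  (F △ G) u v = F u v xor G u v

  _△ᵥ_ : VSet → VSet → VSet
  (A △ᵥ B) w = A w xor B w

  ⟨⟩-cong : ∀ x {F G} → (∀ u v → F u v ≡ G u v) → x ⟨ F ⟩ ≈ x ⟨ G ⟩
  ⟨⟩-cong x F≗G = sumE-cong (λ u v → reflexive (≡.cong (λ b → if isEdge u v ∧ b then x u v else 0#) (F≗G u v)))

  ⟨⟩-△ : ∀ x F G → x ⟨ F ⟩ + x ⟨ G ⟩ ≈ x ⟨ F △ G ⟩ + (x ⟨ F ∩ G ⟩ + x ⟨ F ∩ G ⟩)
  ⟨⟩-△ x F G = begin-equality
    x ⟨ F ⟩ + x ⟨ G ⟩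
      ≈⟨ sumE-+ (restrict x F) (restrict x G) ⟨
    sumE (λ u v → restrict x F u v + restrict x G u v)
      ≈⟨ sumE-cong (λ u v → pointwise (isEdge u v) (F u v) (G u v) (x u v)) ⟩
    sumE (λ u v → restrict x (F △ G) u v + (restrict x (F ∩ G) u v + restrict x (F ∩ G) u v))
      ≈⟨ trans (sumE-+ _ _) (+-congˡ (sumE-+ _ _)) ⟩
    x ⟨ F △ G ⟩ + (x ⟨ F ∩ G ⟩ + x ⟨ F ∩ G ⟩) ∎
    where
    pointwise : ∀ e a b p →
      (if e ∧ a then p else 0#) + (if e ∧ b then p else 0#) ≈
      (if e ∧ (a xor b) then p else 0#) + ((if e ∧ (a ∧ b) then p else 0#) + (if e ∧ (a ∧ b) then p else 0#))
    pointwise false _     _     p = +-congˡ (sym (+-identityʳ 0#))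
    pointwise true  true  true  p = sym (+-identityˡ (p + p))
    pointwise true  true  false p = +-congˡ (sym (+-identityʳ 0#))
    pointwise true  false true  p = trans (+-comm 0# p) (+-congˡ (sym (+-identityʳ 0#)))
    pointwise true  false false p = +-congˡ (sym (+-identityʳ 0#))

  δ-△ᵥ : ∀ A B u v → δ (A △ᵥ B) u v ≡ (δ A △ δ B) u v
  δ-△ᵥ A B u v = xor-interchange (A u) (B u) (A v) (B v)

  ⟨δ⟩-△ᵥ : ∀ x A B → x ⟨ δ A ⟩ + x ⟨ δ B ⟩ ≈ x ⟨ δ (A △ᵥ B) ⟩ + (x ⟨ δ A ∩ δ B ⟩ + x ⟨ δ A ∩ δ B ⟩)
  ⟨δ⟩-△ᵥ x A B = trans (⟨⟩-△ x (δ A) (δ B)) (+-congʳ (⟨⟩-cong x (λ u v → ≡.sym (δ-△ᵥ A B u v))))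

  restrict-nonNeg : ∀ x F → (∀ u v → 0# ≤ x u v) → ∀ u v → 0# ≤ restrict x F u v
  restrict-nonNeg x F 0≤x u v with isEdge u v ∧ F u v
  ... | true  = 0≤x u v
  ... | false = ≤-refl

  ⟨⟩-nonNeg : ∀ x F → (∀ u v → 0# ≤ x u v) → 0# ≤ x ⟨ F ⟩
  ⟨⟩-nonNeg x F 0≤x = sumFin-nonNeg {n} _ (λ u → sumFin-nonNeg {n} _ (restrict-nonNeg x F 0≤x u))

  ⟨⟩-≥-entry : ∀ x F → (∀ u v → 0# ≤ x u v) →
               ∀ {u v} → isEdge u v ∧ F u v ≡ true → x u v ≤ x ⟨ F ⟩
  ⟨⟩-≥-entry x F 0≤x {u} {v} uv∈F = begin
    x u v                     ≡⟨ restrict-∈ ⟨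
    restrict x F u v          ≤⟨ sumFin-≥-term {n} _ (restrict-nonNeg x F 0≤x u) v ⟩
    sumFin (restrict x F u)   ≤⟨ sumFin-≥-term {n} _ (λ w → sumFin-nonNeg {n} _ (restrict-nonNeg x F 0≤x w)) u ⟩
    x ⟨ F ⟩ ∎
    where
    restrict-∈ : restrict x F u v ≡ x u v
    restrict-∈ rewrite uv∈F = ≡.refl

  χ-nonNeg : ∀ T u v → 0# ≤ χ T u v
  χ-nonNeg T u v with T u v
  ... | true  = 0≤1
  ... | false = ≤-refl

  HasEdge : EdgeSet → Set
  HasEdge T = ∃[ u ] ∃[ v ] (isEdge u v ∧ T u v ≡ true)

  EdgeFree : EdgeSet → Set
  EdgeFree T = ∀ u v → isEdge u v ≡ true → T u v ≡ false

  edgeFree⊎hasEdge : ∀ T → EdgeFree T ⊎ HasEdge T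
  edgeFree⊎hasEdge T with any? (λ u → any? (λ v → isEdge u v ∧ T u v Bool.≟ true))
  ... | yes hit  = inj₂ hit
  ... | no ¬hit = inj₁ (λ u v e → not-true (λ t → ¬hit (u , v , ≡.cong₂ _∧_ e t)))
    where
    not-true : ∀ {b} → ¬ (b ≡ true) → b ≡ false
    not-true {false} _   = ≡.refl
    not-true {true}  b≢t = ⊥-elim (b≢t ≡.refl)

  χ-⟨⟩-≥1 : ∀ T F → HasEdge (T ∩ F) → 1# ≤ χ T ⟨ F ⟩
  χ-⟨⟩-≥1 T F (u , v , hit) = begin
    1#         ≡⟨ ≡.cong (λ b → if b then 1# else 0#) (proj₁ (split {isEdge u v} hit)) ⟨
    χ T u v    ≤⟨ ⟨⟩-≥-entry (χ T) F (χ-nonNeg T) (proj₂ (split {isEdge u v} hit)) ⟩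
    χ T ⟨ F ⟩ ∎
    where
    split : ∀ {e a b} → e ∧ (a ∧ b) ≡ true → (a ≡ true) × (e ∧ b ≡ true)
    split {true} {true} {true} _ = ≡.refl , ≡.refl

  average : ℕ → (ℕ → EdgeSet) → EdgeVec
  average r S u v = fromℕ r ⁻¹ * sumℕ r (λ k → χ (S (suc k)) u v)

  -- For r = 0 both sides vanish, whatever the junk value 0 ⁻¹ is.
  *-average-⟨⟩ : ∀ r S F → fromℕ r * average r S ⟨ F ⟩ ≈ sumℕ r (λ k → χ (S (suc k)) ⟨ F ⟩)
  *-average-⟨⟩ zero    S F = zeroˡ _
  *-average-⟨⟩ (suc r) S F = begin-equality
    R * average (suc r) S ⟨ F ⟩   ≈⟨ *-congˡ (trans (⟨⟩-* (R ⁻¹) _ F) (*-congˡ (⟨⟩-sumℕ (suc r) (λ k → χ (S (suc k))) F))) ⟩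
    R * (R ⁻¹ * Σ)                ≈⟨ *-assoc R (R ⁻¹) Σ ⟨
    (R * R ⁻¹) * Σ                ≈⟨ *-congʳ (⁻¹-inverse R (fromℕ-suc≉0 r)) ⟩
    1# * Σ                        ≈⟨ *-identityˡ Σ ⟩
    Σ ∎
    where
    R = fromℕ (suc r)
    Σ = sumℕ (suc r) (λ k → χ (S (suc k)) ⟨ F ⟩)

  hitting-trees-≤ : ∀ j r S F → (∀ k → j ℕ.< k → k ℕ.≤ r → HasEdge (S k ∩ F)) →
                    fromℕ r ≤ fromℕ j + fromℕ r * average r S ⟨ F ⟩
  hitting-trees-≤ j r S F hit = begin
    fromℕ r                                      ≤⟨ sumℕ-≥-count j r _ (λ k → ⟨⟩-nonNeg _ F (χ-nonNeg (S (suc k))))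
                                                       (λ k j≤k k<r → χ-⟨⟩-≥1 (S (suc k)) F (hit (suc k) (s≤s j≤k) k<r)) ⟩
    fromℕ j + sumℕ r (λ k → χ (S (suc k)) ⟨ F ⟩) ≈⟨ +-congˡ (*-average-⟨⟩ r S F) ⟨
    fromℕ j + fromℕ r * average r S ⟨ F ⟩ ∎

module NarrowChainProperties (K : OrderedField) (n : ℕ)
  {s t : Fin n} {x* : Graph.EdgeVec K n} {ℓ : ℕ} {U : ℕ → Graph.VSet K n}
  (chain : Graph.NarrowChain K n s t x* ℓ U) where
  open OrderedField K
  open Graph K n
  open GraphProperties K n

  private
    U₀≡[s] : ∀ w → U 0 w ≡ singleton s w
    U₀≡[s] = proj₁ chain
    Uℓ≡V∖[t] : ∀ w → U ℓ w ≡ not (singleton t w)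
    Uℓ≡V∖[t] = proj₁ (proj₂ chain)
    grow : ∀ m → m ℕ.< ℓ → (∀ w → U m w ≡ true → U (suc m) w ≡ true)
                          × (∃[ w ] (U m w ≡ false × U (suc m) w ≡ true))
    grow = proj₁ (proj₂ (proj₂ chain))

  singleton-self : ∀ w → singleton w w ≡ true
  singleton-self w = ≡.trans (isYes≗does (w ≟ w)) (dec-true (w ≟ w) ≡.refl)

  ⊆-chain : ∀ {m m′} → m ℕ.≤ m′ → m′ ℕ.≤ ℓ → ∀ w → U m w ≡ true → U m′ w ≡ true
  ⊆-chain m≤m′ = go (ℕ.≤⇒≤′ m≤m′)
    where
    go : ∀ {m m′} → m ℕ.≤′ m′ → m′ ℕ.≤ ℓ → ∀ w → U m w ≡ true → U m′ w ≡ true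
    go ℕ.≤′-refl         _       w = id
    go (ℕ.≤′-step m≤′m′) m′<ℓ w = proj₁ (grow _ m′<ℓ) w ∘ go m≤′m′ (ℕ.<⇒≤ m′<ℓ) w

  s∈U : ∀ {m} → m ℕ.≤ ℓ → U m s ≡ true
  s∈U m≤ℓ = ⊆-chain z≤n m≤ℓ s (≡.trans (U₀≡[s] s) (singleton-self s))

  t∉U : ∀ {m} → m ℕ.≤ ℓ → U m t ≡ false
  t∉U {m} m≤ℓ with U m t in t∈Uₘ
  ... | false = ≡.refl
  ... | true  = contradiction (≡.trans (≡.sym (⊆-chain m≤ℓ ℕ.≤-refl t t∈Uₘ)) t∉Uℓ) (λ ())
    where
    t∉Uℓ : U ℓ t ≡ false
    t∉Uℓ = ≡.trans (Uℓ≡V∖[t] t) (≡.cong not (singleton-self t))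

  -- For h < i, U h △ U i = U i ∖ U h is nonempty, proper, and misses both s and t.
  2≤⟨δ[U△U]⟩ : LPFeasible s t x* → ∀ {h i} → h ℕ.< i → i ℕ.≤ ℓ → 2# ≤ x* ⟨ δ (U h △ᵥ U i) ⟩
  2≤⟨δ[U△U]⟩ feasible {h} {i} h<i i≤ℓ = proj₁ feasible (U h △ᵥ U i) ((w , w∈W) , (s , s∉W)) s,t∉W
    where
    h≤ℓ = ℕ.<⇒≤ (ℕ.<-≤-trans h<i i≤ℓ)
    new = proj₂ (grow h (ℕ.<-≤-trans h<i i≤ℓ))
    w = proj₁ new
    w∈W : (U h △ᵥ U i) w ≡ true
    w∈W = ≡.cong₂ _xor_ (proj₁ (proj₂ new)) (⊆-chain h<i i≤ℓ w (proj₂ (proj₂ new)))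
    s∉W : (U h △ᵥ U i) s ≡ false
    s∉W = ≡.cong₂ _xor_ (s∈U h≤ℓ) (s∈U i≤ℓ)
    s,t∉W : ((U h △ᵥ U i) s xor (U h △ᵥ U i) t) ≡ false
    s,t∉W = ≡.cong₂ _xor_ s∉W (≡.cong₂ _xor_ (t∉U h≤ℓ) (t∉U i≤ℓ))

lemma6 : (K : OrderedField) (n : ℕ) →
    let open OrderedField K in
    let open Graph K n in
    (s t : Fin n) → s ≢ t →
    (c : Fin n → Fin n → Carrier) → IsMetric c →
    (x* : EdgeVec) → LPOptimal c s t x* →
    (ℓ : ℕ) (U : ℕ → VSet) → NarrowChain s t x* ℓ U →
    (r : ℕ) (S : ℕ → EdgeSet) →
    (∀ k → 1 ℕ.≤ k → k ℕ.≤ r → IsSpanningTree (S k)) →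
    (ε : Carrier) → 0# ≤ ε →
    let x : EdgeVec
        x u v = (fromℕ r) ⁻¹ * sumℕ r (λ k → χ (S (suc k)) u v) in
    x ⟨ δv s ⟩ ≈ 1# → x ⟨ δv t ⟩ ≈ 1# →
    (∀ F → ((x* ⟨ F ⟩ - ε) ≤ x ⟨ F ⟩) × (x ⟨ F ⟩ ≤ (x* ⟨ F ⟩ + ε))) →
    (θ : ℕ → ℤ) →
    (∀ m → m ℕ.≤ ℓ → IsCeiling (fromℕ r * ((2# - x* ⟨ δ (U m) ⟩) - ε)) (θ m)) →
    (h i j : ℕ) → h ℕ.< i → i ℕ.≤ ℓ → 1 ℕ.≤ j → j ℕ.≤ r →
    (+ j) ℤ.≤ θ h → (+ j) ℤ.≤ θ i →
    ∃[ k ] (j ℕ.≤ k × k ℕ.≤ r ×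
      (∀ u v → isEdge u v ≡ true → ((S k ∩ δ (U h)) ∩ δ (U i)) u v ≡ false))
lemma6 K n s t _ _ _ x* (feasible , _) ℓ U chain r S _ ε _ _ _ ε-close θ θ-ceil
       h i (suc j) h<i i≤ℓ (s≤s z≤n) _ 1+j≤θₕ 1+j≤θᵢ =
  Sum.[ shrink , ⊥-elim ∘ absurd ]′ (bounded-search edgeFree⊎hitsF (suc j) (suc r))
  where
  open OrderedField K hiding (+-mono-≤)
  open Graph K n
  open OrderedFieldProperties K
  open GraphProperties K n
  open NarrowChainProperties K n chain

  F : EdgeSet
  F = δ (U h) ∩ δ (U i)

  T : ℕ → EdgeSet
  T k = (S k ∩ δ (U h)) ∩ δ (U i)

  edgeFree⊎hitsF : ∀ k → EdgeFree (T k) ⊎ HasEdge (S k ∩ F)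
  edgeFree⊎hitsF k = Sum.map₂ reassociate (edgeFree⊎hasEdge (T k))
    where
    reassociate : HasEdge (T k) → HasEdge (S k ∩ F)
    reassociate (u , v , hit) = u , v , ≡.trans (≡.cong (isEdge u v ∧_) (≡.sym (∧-assoc (S k u v) _ _))) hit

  shrink : ∃[ k ] (suc j ℕ.≤ k × k ℕ.< suc r × EdgeFree (T k)) →
           ∃[ k ] (suc j ℕ.≤ k × k ℕ.≤ r × EdgeFree (T k))
  shrink (k , j≤k , k<1+r , free) = k , j≤k , s≤s⁻¹ k<1+r , free

  absurd : (∀ k → suc j ℕ.≤ k → k ℕ.< suc r → HasEdge (S k ∩ F)) → ⊥
  absurd hit = two-ceilings-absurd (fromℕ-nonNeg r)
    (IsCeiling-suc≤⇒< j (θ-ceil h (ℕ.<⇒≤ (ℕ.<-≤-trans h<i i≤ℓ))) 1+j≤θₕ)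
    (IsCeiling-suc≤⇒< j (θ-ceil i i≤ℓ) 1+j≤θᵢ)
    (2≤⟨δ[U△U]⟩ feasible h<i i≤ℓ)
    (⟨δ⟩-△ᵥ x* (U h) (U i))
    (proj₂ (ε-close F))
    (hitting-trees-≤ j r S F (λ k j<k k≤r → hit k j<k (s≤s k≤r)))
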